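{- Let $G$ be a bipartite graph and let $M$ be a maximal matching in $G$. Let $x:V(M)\to V(G)\cup\{\bot\}$ be any mapping such that for each $v\in V(M)$, $x(v)\in N_G(v)\setminus V(M)$, or $x(v)=\bot$ if $N_G(v)\setminus V(M)=\emptyset$. Let $W=V(M)\cup\{x(v):v\in V(M)\}\setminus\{\bot\}$. Then either $M$ is a maximum matching in $G$, or there exists an augmenting path for $M$ in $G[W]$.
   Context: $V(M)$ is the set of vertices covered by $M$, $N_G(v)$ is the neighborhood of $v$, and $G[W]$ is the induced subgraph on $W$. An augmenting path for $M$ is a path whose endpoints are not covered by $M$ and whose edges alternate between edges not in $M$ and edges in $M$. -}

module Defs where

open import Level using (0ℓ)
open import Data.Nat using (ℕ; _≤_)
open import Data.Fin using (Fin)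
open import Data.Bool using (Bool; true; false; not)
open import Data.Maybe using (Maybe; just; nothing)
open import Data.List using (List; []; _∷_; _∷ʳ_; length; concatMap)
open import Data.List.Relation.Unary.Any using (Any)
open import Data.List.Relation.Unary.All using (All)
open import Data.List.Relation.Unary.Unique.Propositional using (Unique)
open import Data.Product using (Σ; ∃; ∃-syntax; _×_; _,_; proj₁; proj₂)
open import Data.Sum using (_⊎_)
open import Data.Unit using (⊤)
open import Relation.Nullary using (¬_)
open import Relation.Binary.PropositionalEquality using (_≡_; _≢_)
open import Relation.Binary.Definitions using (Decidable)

record Graph (n : ℕ) : Set₁ where
  field
    Adj     : Fin n → Fin n → Set
    adj?    : Decidable Adj
    sym     : ∀ {u v} → Adj u v → Adj v u
    irrefl  : ∀ {u} → ¬ Adj u u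
open Graph public

Bipartite : ∀ {n} → Graph n → Set
Bipartite {n} G = Σ (Fin n → Bool) λ c → ∀ {u v} → Adj G u v → c u ≢ c v

EdgeList : ℕ → Set
EdgeList n = List (Fin n × Fin n)

endpoints : ∀ {n} → EdgeList n → List (Fin n)
endpoints = concatMap (λ e → proj₁ e ∷ proj₂ e ∷ [])

IsMatching : ∀ {n} → Graph n → EdgeList n → Set
IsMatching G M = All (λ e → Adj G (proj₁ e) (proj₂ e)) M × Unique (endpoints M)

Covered : ∀ {n} → EdgeList n → Fin n → Set
Covered M v = Any (λ e → proj₁ e ≡ v ⊎ proj₂ e ≡ v) M

InM : ∀ {n} → EdgeList n → Fin n → Fin n → Set
InM M u v = Any (λ e → e ≡ (u , v) ⊎ e ≡ (v , u)) M

IsMaximalMatching : ∀ {n} → Graph n → EdgeList n → Set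
IsMaximalMatching G M =
  IsMatching G M × (∀ u v → Adj G u v → ¬ IsMatching G ((u , v) ∷ M))

IsMaximumMatching : ∀ {n} → Graph n → EdgeList n → Set
IsMaximumMatching G M =
  IsMatching G M × (∀ M′ → IsMatching G M′ → length M′ ≤ length M)

-- The Bool says whether the next edge must be in M.
AltIn : ∀ {n} → Graph n → EdgeList n → Bool → List (Fin n) → Set
AltIn G M b []            = ⊤
AltIn G M b (u ∷ [])      = ⊤
AltIn G M true  (u ∷ v ∷ ps) = Adj G u v × InM M u v × AltIn G M false (v ∷ ps)
AltIn G M false (u ∷ v ∷ ps) = Adj G u v × ¬ InM M u v × AltIn G M true (v ∷ ps)

IsAugmentingPathIn : ∀ {n} → Graph n → EdgeList n → (Fin n → Set) → List (Fin n) → Set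
IsAugmentingPathIn G M W ps =
  Σ _ λ u → Σ _ λ mid → Σ _ λ v →
    (ps ≡ u ∷ (mid ∷ʳ v)) × Unique ps × All W ps × AltIn G M false ps
    × ¬ Covered M u × ¬ Covered M v

{-# OPTIONS --safe #-}
-- If M is not maximum, Berge's lemma gives an augmenting path, proved by induction on the size of a
-- larger matching M′: some p is covered by M′ but not by M; let q be its M′-partner. If q is free
-- in M, p q is augmenting; otherwise remove pq from M′ and q's M-edge qr from M, and splice p q
-- onto the end r of the augmenting path obtained for the smaller pair (if the path does not end
-- at r, it is already augmenting for M).
--
-- Maximality of M rules out augmenting paths with one edge, so an augmenting path u y … y′ v has
-- covered neighbours y, y′ of its free ends, and replacing u by x(y) and v by x(y′) keeps it
-- alternating. The new ends are distinct because in a bipartite graph the ends of an augmenting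
-- path have different colours. The dichotomy itself is decided by searching all duplicate-free
-- lists of vertices.
module Submission where

open import Defs
open import Data.Nat using (ℕ)
open import Data.Fin using (Fin)
open import Data.Maybe using (Maybe; just; nothing)
open import Data.List using (List)
open import Data.Product using (Σ; ∃; _×_; _,_)
open import Data.Sum using (_⊎_)
open import Relation.Nullary using (¬_)
open import Relation.Binary.PropositionalEquality using (_≡_)

open import Level using (0ℓ)
open import Function using (_∘_; id)
open import Data.Bool using (Bool; true; false; not; _xor_)
open import Data.Bool.Properties using (¬-not; not-¬; not-involutive)
open import Data.Nat using (suc; _+_; _≤_; _<_; z≤n; s≤s; s<s⁻¹)
open import Data.Nat.Properties
  using (≤-reflexive; ≮⇒≥; <⇒≱; +-suc; +-mono-<; m≤m+n; n≤1+n; module ≤-Reasoning)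
open import Data.Nat.Induction using (<-wellFounded)
open import Induction.WellFounded using (Acc; acc)
open import Data.Fin using (_≟_)
import Data.Fin.Properties as Fin
open import Data.List using ([]; _∷_; _∷ʳ_; length; reverse; reverseAcc)
open import Data.List.Properties
  using (length-removeAt′; length-tabulate; length-++; unfold-reverse; reverse-++)
open import Data.List.Relation.Unary.Any as Any using (Any; here; there; _─_)
open import Data.List.Relation.Unary.Any.Properties using (lookup-result)
open import Data.List.Relation.Unary.All as All using (All; []; _∷_)
open import Data.List.Relation.Unary.All.Properties using (∷ʳ⁺; ∷ʳ⁻; ¬All⇒Any¬; ¬Any⇒All¬)
open import Data.List.Relation.Unary.AllPairs as AllPairs using ([]; _∷_)
open import Data.List.Relation.Unary.Unique.Propositional using (Unique)
import Data.List.Relation.Unary.Unique.DecPropositional as UniqueDec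
open import Data.List.Membership.Propositional using (_∈_; _∉_; find)
open import Data.List.Membership.Propositional.Properties using (∈-allFin)
open import Data.List.Relation.Binary.Permutation.Propositional
  using (_↭_; refl; prep; swap; trans; ↭-refl; ↭-prep; ↭-swap; ↭-trans; ↭-sym; ↭⇒↭ₛ)
open import Data.List.Relation.Binary.Permutation.Propositional.Properties
  using (Any-resp-↭; All-resp-↭; ↭-reverse; shifts; ++⁺ˡ)
import Data.List.Relation.Binary.Permutation.Setoid.Properties as ↭ₛ
open import Data.Product using (∃-syntax; -,_; proj₁; proj₂)
import Data.Product as Prod
open import Data.Product.Properties using (≡-dec)
open import Data.Sum using (inj₁; inj₂)
import Data.Sum as Sum
open import Data.Unit using (tt)
open import Data.Empty using (⊥-elim)
open import Relation.Nullary using (Dec; yes; no; contradiction)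
import Relation.Nullary.Decidable as Dec
open import Relation.Nullary.Decidable using (_×-dec_; _⊎-dec_; ¬?)
open import Relation.Unary using (Pred; Decidable; U; _⊆_)
open import Relation.Unary.Properties using (U?)
open import Relation.Binary.Definitions using (DecidableEquality)
open import Relation.Binary.PropositionalEquality using (_≢_; refl; ≢-sym; module ≡-Reasoning)
import Relation.Binary.PropositionalEquality as ≡

private
  variable
    A : Set
    P Q : Pred A 0ℓ
    xs ys : List A

↭-lookup∷─ : (i : Any P xs) → xs ↭ Any.lookup i ∷ (xs ─ i)
↭-lookup∷─ (here _) = ↭-refl
↭-lookup∷─ {xs = x ∷ _} (there i) = ↭-trans (↭-prep x (↭-lookup∷─ i)) (↭-swap x _ ↭-refl)

Any-─⁻ : (i : Any P xs) → Any Q (xs ─ i) → Any Q xs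
Any-─⁻ i = Any-resp-↭ (↭-sym (↭-lookup∷─ i)) ∘ there

Any-─⁺ : (i : Any P xs) → Any Q xs → Q (Any.lookup i) ⊎ Any Q (xs ─ i)
Any-─⁺ i = Any.toSum ∘ Any-resp-↭ (↭-lookup∷─ i)

length-─ : (i : Any P xs) → length xs ≡ suc (length (xs ─ i))
length-─ {xs = xs} i = length-removeAt′ xs (Any.index i)

Unique∧⊆⇒length≤ : Unique xs → All (_∈ ys) xs → length xs ≤ length ys
Unique∧⊆⇒length≤ [] [] = z≤n
Unique∧⊆⇒length≤ {xs = x ∷ xs} {ys = ys} (x∉xs ∷ xs!) (x∈ys ∷ xs⊆ys) = begin
  suc (length xs)          ≤⟨ s≤s (Unique∧⊆⇒length≤ xs! xs⊆ys─x) ⟩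
  suc (length (ys ─ x∈ys)) ≡⟨ length-─ x∈ys ⟨
  length ys                ∎
  where
  open ≤-Reasoning
  ∈-─ : ∀ {y} → x ≢ y → y ∈ ys → y ∈ (ys ─ x∈ys)
  ∈-─ x≢y y∈ys with Any-─⁺ x∈ys y∈ys
  ... | inj₁ y≡ = contradiction (≡.trans (lookup-result x∈ys) (≡.sym y≡)) x≢y
  ... | inj₂ y∈ = y∈
  xs⊆ys─x : All (_∈ (ys ─ x∈ys)) xs
  xs⊆ys─x = All.zipWith (Prod.uncurry ∈-─) (x∉xs , xs⊆ys)

Unique⇒length≤ : ∀ {n} {xs : List (Fin n)} → Unique xs → length xs ≤ n
Unique⇒length≤ {n} {xs} xs! =
  ≡.subst (length xs ≤_) (length-tabulate id) (Unique∧⊆⇒length≤ xs! (All.universal ∈-allFin xs))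

module _ (_≟ₐ_ : DecidableEquality A) where

  open import Data.List.Membership.DecPropositional _≟ₐ_ using (_∈?_)

  Unique∧longer⇒∃∉ : {xs ys : List A} → Unique xs → length ys < length xs → ∃ λ x → x ∈ xs × x ∉ ys
  Unique∧longer⇒∃∉ {xs = xs} {ys = ys} xs! ys<xs with All.all? (_∈? ys) xs
  ... | yes xs⊆ys = contradiction (Unique∧⊆⇒length≤ xs! xs⊆ys) (<⇒≱ ys<xs)
  ... | no xs⊈ys = find (¬All⇒Any¬ (_∈? ys) xs xs⊈ys)

Unique-reverse : {xs : List A} → Unique xs → Unique (reverse xs)
Unique-reverse {A} {xs} = ↭ₛ.Unique-resp-↭ (≡.setoid A) (↭⇒↭ₛ (↭-sym (↭-reverse xs)))

All-reverse : All P xs → All P (reverse xs)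
All-reverse {xs = xs} = All-resp-↭ (↭-sym (↭-reverse xs))

All-last : ∀ {u : A} {mid v} → All P (u ∷ mid ∷ʳ v) → P v
All-last = proj₂ ∘ ∷ʳ⁻ ∘ All.tail

reverse-∷-∷ʳ : ∀ (u : A) mid v → reverse (u ∷ mid ∷ʳ v) ≡ v ∷ reverse mid ∷ʳ u
reverse-∷-∷ʳ u mid v = begin
  reverse (u ∷ mid ∷ʳ v)  ≡⟨ unfold-reverse u (mid ∷ʳ v) ⟩
  reverse (mid ∷ʳ v) ∷ʳ u ≡⟨ ≡.cong (_∷ʳ u) (reverse-++ mid (v ∷ [])) ⟩
  v ∷ reverse mid ∷ʳ u    ∎
  where open ≡-Reasoning

∃-length≤? : ∀ {n} {P : Pred (List (Fin n)) 0ℓ} → Decidable P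
           → ∀ k → Dec (∃ λ xs → length xs ≤ k × P xs)
∃-length≤? P? 0 = Dec.map′ (λ p → [] , z≤n , p) (λ { ([] , _ , p) → p }) (P? [])
∃-length≤? P? (suc k) = Dec.map′
  Sum.[ (λ p → [] , z≤n , p) , (λ (x , xs , xs≤k , p) → x ∷ xs , s≤s xs≤k , p) ]′
  (λ { ([] , _ , p) → inj₁ p ; (x ∷ xs , s≤s xs≤k , p) → inj₂ (x , xs , xs≤k , p) })
  (P? [] ⊎-dec Fin.any? λ x → ∃-length≤? (P? ∘ (x ∷_)) k)

module _ {n : ℕ} (G : Graph n) where

  private
    variable
      M M′ : EdgeList n
      W W′ : Pred (Fin n) 0ℓ
      b : Bool
      e : Fin n × Fin n
      p q r u v w x y z : Fin n
      mid : List (Fin n)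

  -- Covered M v and InM M u v unfold to Any (Incident v) M and Any (Joins u v) M.
  Incident : Fin n → Fin n × Fin n → Set
  Incident v e = proj₁ e ≡ v ⊎ proj₂ e ≡ v

  Joins : Fin n → Fin n → Fin n × Fin n → Set
  Joins u v e = e ≡ (u , v) ⊎ e ≡ (v , u)

  Joins⇒Incident : Joins u v e → Incident u e
  Joins⇒Incident (inj₁ refl) = inj₁ refl
  Joins⇒Incident (inj₂ refl) = inj₂ refl

  Joins∧Incident⇒≡ : Joins u v e → Incident z e → u ≡ z ⊎ v ≡ z
  Joins∧Incident⇒≡ (inj₁ refl) = id
  Joins∧Incident⇒≡ (inj₂ refl) = Sum.swap

  Adj⇒≢ : Adj G u v → u ≢ v
  Adj⇒≢ uv refl = irrefl G uv

  InM-sym : InM M u v → InM M v u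
  InM-sym = Any.map Sum.swap

  InM⇒Covered : InM M u v → Covered M u
  InM⇒Covered = Any.map Joins⇒Incident

  Covered⇒InM : Covered M u → ∃ λ v → InM M u v
  Covered⇒InM (here (inj₁ refl)) = -, here (inj₁ refl)
  Covered⇒InM (here (inj₂ refl)) = -, here (inj₂ refl)
  Covered⇒InM (there u∈M) = Prod.map₂ there (Covered⇒InM u∈M)

  Covered⇒∈endpoints : Covered M v → v ∈ endpoints M
  Covered⇒∈endpoints (here (inj₁ refl)) = here refl
  Covered⇒∈endpoints (here (inj₂ refl)) = there (here refl)
  Covered⇒∈endpoints (there v∈M) = there (there (Covered⇒∈endpoints v∈M))

  ∈endpoints⇒Covered : v ∈ endpoints M → Covered M v
  ∈endpoints⇒Covered {M = _ ∷ _} (here refl) = here (inj₁ refl)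
  ∈endpoints⇒Covered {M = _ ∷ _} (there (here refl)) = here (inj₂ refl)
  ∈endpoints⇒Covered {M = _ ∷ _} (there (there v∈)) = there (∈endpoints⇒Covered v∈)

  ¬Covered⇒∉endpoints : ¬ Covered M u → All (u ≢_) (endpoints M)
  ¬Covered⇒∉endpoints u∉M = ¬Any⇒All¬ _ (u∉M ∘ ∈endpoints⇒Covered)

  Covered? : (M : EdgeList n) → Decidable (Covered M)
  Covered? M v = Any.any? (λ e → (proj₁ e ≟ v) ⊎-dec (proj₂ e ≟ v)) M

  InM? : (M : EdgeList n) (u v : Fin n) → Dec (InM M u v)
  InM? M u v = Any.any? (λ e → (e ≟ₑ (u , v)) ⊎-dec (e ≟ₑ (v , u))) M
    where
    _≟ₑ_ : DecidableEquality (Fin n × Fin n)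
    _≟ₑ_ = ≡-dec _≟_ _≟_

  length-endpoints : (M : EdgeList n) → length (endpoints M) ≡ length M + length M
  length-endpoints [] = refl
  length-endpoints (_ ∷ M) =
    ≡.cong suc (≡.trans (≡.cong suc (length-endpoints M)) (≡.sym (+-suc (length M) (length M))))

  endpoints-↭ : M ↭ M′ → endpoints M ↭ endpoints M′
  endpoints-↭ refl = ↭-refl
  endpoints-↭ (prep (a , b) σ) = ↭-prep a (↭-prep b (endpoints-↭ σ))
  endpoints-↭ (swap (a , b) (c , d) σ) =
    ↭-trans (shifts (a ∷ b ∷ []) (c ∷ d ∷ [])) (++⁺ˡ (c ∷ d ∷ a ∷ b ∷ []) (endpoints-↭ σ))
  endpoints-↭ (trans σ τ) = ↭-trans (endpoints-↭ σ) (endpoints-↭ τ)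

  InM⇒Adj : IsMatching G M → InM M u v → Adj G u v
  InM⇒Adj (adj , _) uv with find uv
  ... | _ , e∈M , inj₁ refl = All.lookup adj e∈M
  ... | _ , e∈M , inj₂ refl = sym G (All.lookup adj e∈M)

  IsMatching-resp-↭ : M ↭ M′ → IsMatching G M → IsMatching G M′
  IsMatching-resp-↭ σ (adj , endpoints!) =
    All-resp-↭ σ adj , ↭ₛ.Unique-resp-↭ (≡.setoid (Fin n)) (↭⇒↭ₛ (endpoints-↭ σ)) endpoints!

  IsMatching-∷⇒disjoint : IsMatching G (e ∷ M) → Covered M z → ¬ Incident z e
  IsMatching-∷⇒disjoint (_ , (_ ∷ e₁∉) ∷ _ ∷ _) z∈M (inj₁ refl) =
    All.lookup e₁∉ (Covered⇒∈endpoints z∈M) refl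
  IsMatching-∷⇒disjoint (_ , _ ∷ e₂∉ ∷ _) z∈M (inj₂ refl) =
    All.lookup e₂∉ (Covered⇒∈endpoints z∈M) refl

  IsMatching-∷ : IsMatching G M → Adj G u v → ¬ Covered M u → ¬ Covered M v
               → IsMatching G ((u , v) ∷ M)
  IsMatching-∷ (adj , endpoints!) uv u∉M v∉M =
    uv ∷ adj , (Adj⇒≢ uv ∷ ¬Covered⇒∉endpoints u∉M) ∷ ¬Covered⇒∉endpoints v∉M ∷ endpoints!

  larger⇒∃uncovered : IsMatching G M′ → length M < length M′ → ∃ λ p → Covered M′ p × ¬ Covered M p
  larger⇒∃uncovered {M′ = M′} {M = M} (_ , endpoints!) M<M′ =
    let (p , p∈M′ , p∉M) = Unique∧longer⇒∃∉ _≟_ endpoints! longer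
    in p , ∈endpoints⇒Covered p∈M′ , p∉M ∘ Covered⇒∈endpoints
    where
    longer : length (endpoints M) < length (endpoints M′)
    longer = ≡.subst₂ _<_ (≡.sym (length-endpoints M)) (≡.sym (length-endpoints M′))
                          (+-mono-< M<M′ M<M′)

  ─-free : (qr : InM M q r) → ¬ Covered (M ─ qr) z → z ≢ q → z ≢ r → ¬ Covered M z
  ─-free qr z∉M₁ z≢q z≢r z∈M with Any-─⁺ qr z∈M
  ... | inj₂ z∈M₁ = z∉M₁ z∈M₁
  ... | inj₁ z∈e = Sum.[ z≢q ∘ ≡.sym , z≢r ∘ ≡.sym ]′ (Joins∧Incident⇒≡ (lookup-result qr) z∈e)

  ─-InM : (qr : InM M q r) → x ≢ q → y ≢ q → InM M x y → InM (M ─ qr) x y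
  ─-InM qr x≢q y≢q xy with Any-─⁺ qr xy
  ... | inj₂ xy∈M₁ = xy∈M₁
  ... | inj₁ e-joins-xy =
    ⊥-elim (Sum.[ x≢q , y≢q ]′ (Joins∧Incident⇒≡ e-joins-xy (Joins⇒Incident (lookup-result qr))))

  ─-isMatching : IsMatching G M → (qr : InM M q r) → IsMatching G (M ─ qr)
  ─-isMatching matching qr with IsMatching-resp-↭ (↭-lookup∷─ qr) matching
  ... | _ ∷ adj , _ ∷ _ ∷ endpoints! = adj , endpoints!

  ─-uncovers : IsMatching G M → (qr : InM M q r) → Covered (M ─ qr) z → z ≢ q × z ≢ r
  ─-uncovers {M = M} {z = z} matching qr z∈M₁ =
    avoids (Joins⇒Incident (lookup-result qr)) , avoids (Joins⇒Incident (Sum.swap (lookup-result qr)))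
    where
    avoids : ∀ {a} → Incident a (Any.lookup qr) → z ≢ a
    avoids a∈e refl = IsMatching-∷⇒disjoint (IsMatching-resp-↭ (↭-lookup∷─ qr) matching) z∈M₁ a∈e

  -- Alternating walks

  AltIn-free-start : ∀ {ps} → ¬ Covered M u → AltIn G M b (u ∷ ps) → AltIn G M false (u ∷ ps)
  AltIn-free-start {b = false} _ alt = alt
  AltIn-free-start {b = true} {ps = []} _ _ = tt
  AltIn-free-start {b = true} {ps = _ ∷ _} u∉M (_ , uv∈M , _) = contradiction (InM⇒Covered uv∈M) u∉M

  AltIn-reverse : ∀ ps → AltIn G M b ps → ∃ λ b′ → AltIn G M b′ (reverse ps)
  AltIn-reverse [] _ = false , tt
  AltIn-reverse {M = M} (x ∷ ps) alt = reverse-onto x [] ps tt alt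
    where
    -- pre is the part of the walk already traversed, reversed; its first edge is of the opposite
    -- kind to the next one.
    reverse-onto : ∀ {b} x pre ys → AltIn G M (not b) (x ∷ pre) → AltIn G M b (x ∷ ys)
                 → ∃ λ b′ → AltIn G M b′ (reverseAcc (x ∷ pre) ys)
    reverse-onto x pre [] rev _ = -, rev
    reverse-onto {false} x pre (y ∷ ys) rev (xy , xy∉M , alt) =
      reverse-onto y (x ∷ pre) ys (sym G xy , xy∉M ∘ InM-sym , rev) alt
    reverse-onto {true} x pre (y ∷ ys) rev (xy , xy∈M , alt) =
      reverse-onto y (x ∷ pre) ys (sym G xy , InM-sym xy∈M , rev) alt

  AltIn-transfer : (∀ {x y} → InM M x y → InM M′ x y) → (∀ {x y} → P x → P y → InM M′ x y → InM M x y)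
                 → ∀ ps → All P ps → AltIn G M b ps → AltIn G M′ b ps
  AltIn-transfer _ _ [] _ _ = tt
  AltIn-transfer _ _ (_ ∷ []) _ _ = tt
  AltIn-transfer {b = true} M⊆M′ agree (x ∷ y ∷ ps) (_ ∷ Py ∷ Pps) (xy , xy∈M , alt) =
    xy , M⊆M′ xy∈M , AltIn-transfer M⊆M′ agree (y ∷ ps) (Py ∷ Pps) alt
  AltIn-transfer {b = false} M⊆M′ agree (x ∷ y ∷ ps) (Px ∷ Py ∷ Pps) (xy , xy∉M , alt) =
    xy , xy∉M ∘ agree Px Py , AltIn-transfer M⊆M′ agree (y ∷ ps) (Py ∷ Pps) alt

  ─-AltIn : (qr : InM M q r) → ∀ ps → All (_≢ q) ps → AltIn G (M ─ qr) b ps → AltIn G M b ps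
  ─-AltIn qr = AltIn-transfer (Any-─⁻ qr) (─-InM qr)

  AltIn-interior-covered : ∀ u mid v → AltIn G M b (u ∷ mid ∷ʳ v) → All (Covered M) mid
  AltIn-interior-covered u [] v _ = []
  AltIn-interior-covered {b = true} u (x ∷ mid) v (_ , ux∈M , alt) =
    InM⇒Covered (InM-sym ux∈M) ∷ AltIn-interior-covered x mid v alt
  AltIn-interior-covered {M = M} {b = false} u (x ∷ mid) v (_ , _ , alt) =
    matched-start mid alt ∷ AltIn-interior-covered x mid v alt
    where
    matched-start : ∀ mid → AltIn G M true (x ∷ mid ∷ʳ v) → Covered M x
    matched-start [] (_ , xv∈M , _) = InM⇒Covered xv∈M
    matched-start (_ ∷ _) (_ , xy∈M , _) = InM⇒Covered xy∈M

  AltIn-ends-differ : Bipartite G → ∀ u mid v → AltIn G M false (u ∷ mid ∷ʳ v) → ¬ Covered M v → u ≢ v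
  AltIn-ends-differ {M = M} (c , proper) u mid v alt v∉M refl = not-¬ refl (colour u mid alt)
    where
    -- Colours alternate along the walk, and one that starts with a matching edge and ends at a
    -- free vertex has even length.
    colour : ∀ {b} u mid → AltIn G M b (u ∷ mid ∷ʳ v) → c u ≡ not b xor c v
    colour {false} u [] (uv , _) = ¬-not (proper uv)
    colour {true} u [] (_ , uv∈M , _) = contradiction (InM⇒Covered (InM-sym uv∈M)) v∉M
    colour {false} u (x ∷ mid) (ux , _ , alt) =
      ≡.trans (¬-not (proper ux)) (≡.cong not (colour {true} x mid alt))
    colour {true} u (x ∷ mid) (ux , _ , alt) =
      ≡.trans (¬-not (proper ux))
              (≡.trans (≡.cong not (colour {false} x mid alt)) (not-involutive (c v)))

  -- IsAugmentingPathIn with the ends and the interior as indices, so that proofs never have to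
  -- match on an equation between lists.
  record AugmentingPath (M : EdgeList n) (W : Pred (Fin n) 0ℓ) (u : Fin n) (mid : List (Fin n)) (v : Fin n)
                        : Set where
    constructor augmenting
    field
      unique      : Unique (u ∷ mid ∷ʳ v)
      within      : All W (u ∷ mid ∷ʳ v)
      alternating : AltIn G M false (u ∷ mid ∷ʳ v)
      start-free  : ¬ Covered M u
      end-free    : ¬ Covered M v
  open AugmentingPath public

  ∃AugmentingPath : EdgeList n → Pred (Fin n) 0ℓ → Set
  ∃AugmentingPath M W = ∃[ u ] ∃[ mid ] ∃[ v ] AugmentingPath M W u mid v

  AugmentingPath⇒IsAugmentingPathIn : AugmentingPath M W u mid v
                                    → IsAugmentingPathIn G M W (u ∷ mid ∷ʳ v)
  AugmentingPath⇒IsAugmentingPathIn P =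
    -, -, -, refl , P .unique , P .within , P .alternating , P .start-free , P .end-free

  AugmentingPath-mono : W ⊆ W′ → AugmentingPath M W u mid v → AugmentingPath M W′ u mid v
  AugmentingPath-mono W⊆W′ P =
    augmenting (P .unique) (All.map W⊆W′ (P .within)) (P .alternating) (P .start-free) (P .end-free)

  AugmentingPath-interior-covered : AugmentingPath M W u mid v → All (Covered M) mid
  AugmentingPath-interior-covered {u = u} {mid = mid} {v = v} P =
    AltIn-interior-covered u mid v (P .alternating)

  AugmentingPath-within : Covered M ⊆ W′ → W′ u → W′ v
                        → AugmentingPath M W u mid v → AugmentingPath M W′ u mid v
  AugmentingPath-within V⊆W′ W′u W′v P = augmenting
    (P .unique)
    (W′u ∷ ∷ʳ⁺ (All.map V⊆W′ (AugmentingPath-interior-covered P)) W′v)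
    (P .alternating)
    (P .start-free)
    (P .end-free)

  AugmentingPath-ends-differ : AugmentingPath M W u mid v → u ≢ v
  AugmentingPath-ends-differ P = proj₂ (∷ʳ⁻ (AllPairs.head (P .unique)))

  reverse-augmenting : AugmentingPath M W u mid v → AugmentingPath M W v (reverse mid) u
  reverse-augmenting {M = M} {W = W} {u = u} {mid = mid} {v = v} P =
    let (b′ , alt′) = AltIn-reverse (u ∷ mid ∷ʳ v) (P .alternating) in augmenting
      (≡.subst Unique reversed (Unique-reverse (P .unique)))
      (≡.subst (All W) reversed (All-reverse (P .within)))
      (AltIn-free-start (P .end-free) (≡.subst (AltIn G M b′) reversed alt′))
      (P .end-free)
      (P .start-free)
    where
    reversed : reverse (u ∷ mid ∷ʳ v) ≡ v ∷ reverse mid ∷ʳ u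
    reversed = reverse-∷-∷ʳ u mid v

  edge-augmenting : Adj G u v → ¬ Covered M u → ¬ Covered M v → W u → W v → AugmentingPath M W u [] v
  edge-augmenting uv u∉M v∉M Wu Wv =
    augmenting ((Adj⇒≢ uv ∷ []) ∷ [] ∷ []) (Wu ∷ Wv ∷ []) (uv , u∉M ∘ InM⇒Covered , tt) u∉M v∉M

  maximal⇒¬edge-augmenting : IsMaximalMatching G M → ¬ AugmentingPath M W u [] v
  maximal⇒¬edge-augmenting (matching , maximal) P =
    let uv = proj₁ (P .alternating)
    in maximal _ _ uv (IsMatching-∷ matching uv (P .start-free) (P .end-free))

  -- Berge's lemma

  lift-augmenting : (qr : InM M q r) → u ≢ r → v ≢ r
                  → AugmentingPath (M ─ qr) (λ z → W z × z ≢ q) u mid v → AugmentingPath M W u mid v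
  lift-augmenting {u = u} {v = v} {mid = mid} qr u≢r v≢r P = augmenting
    (P .unique)
    (All.map proj₁ (P .within))
    (─-AltIn qr (u ∷ mid ∷ʳ v) (All.map proj₂ (P .within)) (P .alternating))
    (─-free qr (P .start-free) (proj₂ (All.head (P .within))) u≢r)
    (─-free qr (P .end-free) (proj₂ (All-last (P .within))) v≢r)

  prepend-augmenting : IsMatching G M → (qr : InM M q r) → Adj G p q → ¬ Covered M p → W p → W q
                     → AugmentingPath (M ─ qr) (λ z → W z × z ≢ p × z ≢ q) r mid v
                     → AugmentingPath M W p (q ∷ r ∷ mid) v
  prepend-augmenting {r = r} {mid = mid} {v = v} matching qr pq p∉M Wp Wq P = augmenting
    ((Adj⇒≢ pq ∷ All.map (λ (_ , z≢p , _) → ≢-sym z≢p) (P .within))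
      ∷ All.map (λ (_ , _ , z≢q) → ≢-sym z≢q) (P .within) ∷ P .unique)
    (Wp ∷ Wq ∷ All.map proj₁ (P .within))
    (pq , p∉M ∘ InM⇒Covered , InM⇒Adj matching qr , qr ,
      ─-AltIn qr (r ∷ mid ∷ʳ v) (All.map (proj₂ ∘ proj₂) (P .within)) (P .alternating))
    p∉M
    (─-free qr (P .end-free) (proj₂ (proj₂ (All-last (P .within))))
      (≢-sym (AugmentingPath-ends-differ P)))

  augment-across : IsMatching G M → (qr : InM M q r) → Adj G p q → ¬ Covered M p → W p → W q
                 → AugmentingPath (M ─ qr) (λ z → W z × z ≢ p × z ≢ q) u mid v → ∃AugmentingPath M W
  augment-across {r = r} {u = u} {v = v} matching qr pq p∉M Wp Wq P with u ≟ r | v ≟ r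
  ... | yes refl | _ = -, -, -, prepend-augmenting matching qr pq p∉M Wp Wq P
  ... | no _ | yes refl = -, -, -, prepend-augmenting matching qr pq p∉M Wp Wq (reverse-augmenting P)
  ... | no u≢r | no v≢r = -, -, -, lift-augmenting qr u≢r v≢r (AugmentingPath-mono (Prod.map₂ proj₂) P)

  larger⇒augmenting : IsMatching G M → IsMatching G M′ → length M < length M′
                    → ∃AugmentingPath M (Covered M′)
  larger⇒augmenting m m′ M<M′ = go (<-wellFounded _) m m′ M<M′
    where
    go : Acc _<_ (length M′) → IsMatching G M → IsMatching G M′ → length M < length M′
       → ∃AugmentingPath M (Covered M′)
    go {M′ = M′} {M = M} (acc smaller) m m′ M<M′ with larger⇒∃uncovered m′ M<M′
    ... | p , p∈M′ , p∉M with Covered⇒InM p∈M′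
    ... | q , pq with Covered? M q
    ... | no q∉M = -, -, -, edge-augmenting (InM⇒Adj m′ pq) p∉M q∉M p∈M′ (InM⇒Covered (InM-sym pq))
    ... | yes q∈M with Covered⇒InM q∈M
    ... | r , qr with go (smaller (≤-reflexive (≡.sym (length-─ pq))))
                         (─-isMatching m qr) (─-isMatching m′ pq)
                         (s<s⁻¹ (≡.subst₂ _<_ (length-─ qr) (length-─ pq) M<M′))
    ... | _ , _ , _ , P = augment-across m qr (InM⇒Adj m′ pq) p∉M p∈M′ (InM⇒Covered (InM-sym pq))
                            (AugmentingPath-mono (λ z∈M′₁ → Any-─⁻ pq z∈M′₁ , ─-uncovers m′ pq z∈M′₁) P)

  ¬augmenting⇒maximum : IsMatching G M → ¬ ∃AugmentingPath M U → IsMaximumMatching G M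
  ¬augmenting⇒maximum m ∄P = m , λ M′ m′ → ≮⇒≥ λ M<M′ →
    let (u , mid , v , P) = larger⇒augmenting m m′ M<M′ in ∄P (u , mid , v , AugmentingPath-mono _ P)

  reroute-start : Bipartite G → Adj G y w → ¬ Covered M w → W w
                → AugmentingPath M W u (y ∷ mid) v → AugmentingPath M W w (y ∷ mid) v
  reroute-start {y = y} {w = w} {M = M} {u = u} {mid = mid} {v = v} bipartite yw w∉M Ww P = augmenting
    (∷ʳ⁺ (All.map (λ { z∈M refl → w∉M z∈M }) (AugmentingPath-interior-covered P)) w≢v
      ∷ AllPairs.tail (P .unique))
    (Ww ∷ All.tail (P .within))
    rerouted
    w∉M
    (P .end-free)
    where
    rerouted : AltIn G M false (w ∷ y ∷ mid ∷ʳ v)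
    rerouted = sym G yw , w∉M ∘ InM⇒Covered , proj₂ (proj₂ (P .alternating))
    w≢v : w ≢ v
    w≢v = AltIn-ends-differ bipartite w (y ∷ mid) v rerouted (P .end-free)

  -- Deciding whether an augmenting path exists

  AltIn? : (M : EdgeList n) (b : Bool) (ps : List (Fin n)) → Dec (AltIn G M b ps)
  AltIn? M b [] = yes tt
  AltIn? M b (_ ∷ []) = yes tt
  AltIn? M true (u ∷ v ∷ ps) = adj? G u v ×-dec InM? M u v ×-dec AltIn? M false (v ∷ ps)
  AltIn? M false (u ∷ v ∷ ps) = adj? G u v ×-dec ¬? (InM? M u v) ×-dec AltIn? M true (v ∷ ps)

  AugmentingPath? : (M : EdgeList n) (u : Fin n) (mid : List (Fin n)) (v : Fin n)
                  → Dec (AugmentingPath M U u mid v)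
  AugmentingPath? M u mid v =
    let path = u ∷ mid ∷ʳ v in Dec.map′
      (λ (path! , inU , alt , u∉M , v∉M) → augmenting path! inU alt u∉M v∉M)
      (λ P → P .unique , P .within , P .alternating , P .start-free , P .end-free)
      (UniqueDec.unique? _≟_ path ×-dec All.all? U? path ×-dec AltIn? M false path
        ×-dec ¬? (Covered? M u) ×-dec ¬? (Covered? M v))

  AugmentingPath-mid-length : AugmentingPath M W u mid v → length mid ≤ n
  AugmentingPath-mid-length {u = u} {mid = mid} {v = v} P = begin
    length mid            ≤⟨ m≤m+n (length mid) 1 ⟩
    length mid + 1        ≡⟨ length-++ mid ⟨
    length (mid ∷ʳ v)     ≤⟨ n≤1+n _ ⟩
    length (u ∷ mid ∷ʳ v) ≤⟨ Unique⇒length≤ (P .unique) ⟩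
    n                     ∎
    where open ≤-Reasoning

  augmenting? : (M : EdgeList n) → Dec (∃AugmentingPath M U)
  augmenting? M = Dec.map′
    (λ (u , mid , _ , v , P) → u , mid , v , P)
    (λ (u , mid , v , P) → u , mid , AugmentingPath-mid-length P , v , P)
    (Fin.any? λ u → ∃-length≤? (λ mid → Fin.any? (AugmentingPath? M u mid)) n)

lemmaA2 : ∀ {n} (G : Graph n) (M : EdgeList n) (x : Fin n → Maybe (Fin n))
    → Bipartite G
    → IsMaximalMatching G M
    → (∀ v → Covered M v →
          (Σ (Fin n) λ w → (x v ≡ just w) × Adj G v w × ¬ Covered M w)
        ⊎ ((x v ≡ nothing) × (∀ w → Adj G v w → Covered M w)))
    → IsMaximumMatching G M
      ⊎ Σ (List (Fin n)) (IsAugmentingPathIn G M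
          (λ w → Covered M w ⊎ Σ (Fin n) λ v → Covered M v × (x v ≡ just w)))
lemmaA2 {n} G M x bipartite maximal@(matching , _) choice with augmenting? G M
... | no ∄P = inj₁ (¬augmenting⇒maximum G matching ∄P)
... | yes (_ , _ , _ , P) =
  let (w₁ , P₁ , w₁∈W) = reroute P
      (w₂ , P₂ , w₂∈W) = reroute (reverse-augmenting G P₁)
  in inj₂ (-, AugmentingPath⇒IsAugmentingPathIn G (AugmentingPath-within G inj₁ w₂∈W w₁∈W P₂))
  where
  W : Pred (Fin n) 0ℓ
  W w = Covered M w ⊎ Σ (Fin n) λ v → Covered M v × (x v ≡ just w)

  reroute : ∀ {u mid v} → AugmentingPath G M U u mid v → ∃ λ w → AugmentingPath G M U w mid v × W w
  reroute {mid = []} P = ⊥-elim (maximal⇒¬edge-augmenting G maximal P)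
  reroute {u} {y ∷ _} P with All.head (AugmentingPath-interior-covered G P)
  ... | y∈M with choice y y∈M
  ... | inj₁ (w , xy≡w , yw , w∉M) = w , reroute-start G bipartite yw w∉M tt P , inj₂ (y , y∈M , xy≡w)
  ... | inj₂ (_ , all-covered) = ⊥-elim (P .start-free (all-covered u (sym G (proj₁ (P .alternating)))))
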